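{- Let $n\in\mathbb{N}$ with $n\ge2$. Then \[ \int_{\mathbb{Z}_p} x^2x^{[n-2]}\,d\mu_{ -1}(x)=\sum_{k=0}^{n}t(n,k)E_k+\left(\frac{n-2}{2}\right)^2\sum_{k=0}^{n-2}t(n-2,k)E_k . \]
   Context: $p$ is an odd prime. For a polynomial $f:\mathbb{Z}_p\to\mathbb{C}_p$ the fermionic $p$-adic integral is $\int_{\mathbb{Z}_p} f(x)\,d\mu_{ -1}(x)=\lim_{N\to\infty}\sum_{x=0}^{p^N-1}(-1)^xf(x)$. The central factorial is $x^{[0]}=1$ and, for $n\in\mathbb{N}$, $x^{[n]}=x\prod_{j=1}^{n-1}\left(x+\frac n2-j\right)$; the central factorial numbers of the first kind $t(n,k)$ are defined by $x^{[n]}=\sum_{k=0}^n t(n,k)x^k$. The Euler numbers $E_k$ are defined by $\frac{2}{e^t+1}=\sum_{k\ge0}E_k\frac{t^k}{k!}$. -}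

module Defs where

open import Data.Nat as ℕ using (ℕ; zero; suc; _∸_; _^_; _≤_; _<ᵇ_; _≡ᵇ_)
open import Data.Nat.Divisibility using (_∣_)
open import Data.Nat.Combinatorics using (_C_)
open import Data.Integer as ℤ using (ℤ; +_)
open import Data.Rational using (ℚ; 0ℚ; 1ℚ; ½; _+_; _*_; _-_; -_; _/_)
open import Data.List using (List; []; _∷_)
open import Data.Bool using (if_then_else_)
open import Data.Product using (_×_; ∃)
open import Relation.Nullary using (¬_)

ℕtoℚ : ℕ → ℚ
ℕtoℚ n = + n / 1

sumTo : ℕ → (ℕ → ℚ) → ℚ
sumTo zero    f = 0ℚ
sumTo (suc n) f = sumTo n f + f n

prodTo : ℕ → (ℕ → ℚ) → ℚ
prodTo zero    f = 1ℚ
prodTo (suc n) f = prodTo n f * f n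

-- central factorial x^{[n]} = x Π_{j=1}^{n-1} (x + n/2 - j), x^{[0]} = 1
cfac : ℕ → ℚ → ℚ
cfac zero    x = 1ℚ
cfac (suc m) x = x * prodTo m (λ i → x + ℕtoℚ (suc m) * ½ - ℕtoℚ (suc i))

-- polynomials with rational coefficients, as ascending coefficient lists
Poly : Set
Poly = List ℚ

scale : ℚ → Poly → Poly
scale c []       = []
scale c (a ∷ as) = c * a ∷ scale c as

addP : Poly → Poly → Poly
addP []       q        = q
addP (a ∷ as) []       = a ∷ as
addP (a ∷ as) (b ∷ bs) = a + b ∷ addP as bs

mulX : Poly → Poly
mulX q = 0ℚ ∷ q

mulLin : ℚ → Poly → Poly
mulLin c q = addP (mulX q) (scale c q)

prodLinTo : ℕ → (ℕ → ℚ) → Poly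
prodLinTo zero    c = 1ℚ ∷ []
prodLinTo (suc m) c = mulLin (c m) (prodLinTo m c)

cfacPoly : ℕ → Poly
cfacPoly zero    = 1ℚ ∷ []
cfacPoly (suc m) = mulX (prodLinTo m (λ i → ℕtoℚ (suc m) * ½ - ℕtoℚ (suc i)))

coeff : Poly → ℕ → ℚ
coeff []       k       = 0ℚ
coeff (a ∷ as) zero    = a
coeff (a ∷ as) (suc k) = coeff as k

t : ℕ → ℕ → ℚ
t n k = coeff (cfacPoly n) k

-- Euler numbers from 2/(e^t+1) = Σ E_k t^k/k!, i.e. (e^t+1)·E(t) = 2:
-- E_0 = 1 and E_n = -(1/2) Σ_{j<n} C(n,j) E_j for n ≥ 1.
-- eTable n k is correct for k < n.
eTable : ℕ → ℕ → ℚ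
eTable zero    k = 0ℚ
eTable (suc n) k =
  if k <ᵇ n then eTable n k
  else (if n ≡ᵇ 0 then 1ℚ
        else - (½ * sumTo n (λ j → ℕtoℚ (n C j) * eTable n j)))

E : ℕ → ℚ
E k = eTable (suc k) k

sgn : ℕ → ℚ
sgn zero    = 1ℚ
sgn (suc x) = - sgn x

fermiSum : ℕ → (ℚ → ℚ) → ℕ → ℚ
fermiSum p f N = sumTo (p ^ N) (λ x → sgn x * f (ℕtoℚ x))

-- q ∈ p^m ℤ_(p), i.e. |q|_p ≤ p^{-m}
padicSmall : ℕ → ℕ → ℚ → Set
padicSmall p m q = (¬ (p ∣ ℚ.denominatorℕ q)) × (p ^ m ∣ ℤ.∣ ℚ.numerator q ∣)

FermionicIntegral≡ : ℕ → (ℚ → ℚ) → ℚ → Set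
FermionicIntegral≡ p f L =
  ∀ (m : ℕ) → ∃ λ (N₀ : ℕ) → ∀ (N : ℕ) → N₀ ≤ N → padicSmall p m (fermiSum p f N - L)

{-# OPTIONS --safe #-}

-- For odd M the alternating power sums T_k = Σ_{x<M} (-1)^x x^k satisfy
-- Σ_{j≤k} C(k,j) T_j + T_k = 0^k + M^k (telescope x ↦ (x+1)^k and expand
-- binomially), while the Euler numbers satisfy the same relation with 2·0^k on
-- the right.  Hence the defects T_k - E_k obey Σ_{j≤k} C(k,j) D_j + D_k = M^k - 0^k,
-- a recursion with a factor ½ whose solutions all lie in M ℤ_(p) once p is odd.  Writing
-- x² x^[n-2] = x^[n] + ((n-2)/2)² x^[n-2] and expanding the central factorials
-- in monomials with p-integral coefficients t(n,k), the sums over x < p^N differ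
-- from the claimed value by an element of p^N ℤ_(p).

module Submission where

open import Defs
open import Function using (_∘_)
open import Function.Bundles using (Equivalence)
open import Data.Bool using (false)
open import Data.Bool.Properties using (T-≡; if-cong)
open import Data.List using ([]; _∷_)
open import Data.Product using (_,_)
open import Data.Sum using (inj₁; inj₂)
open import Data.Nat as ℕ using (ℕ; zero; suc; _∸_; _≤_; _<_; z≤n; s≤s; _<ᵇ_; _%_)
import Data.Nat.Properties as ℕ
open import Data.Nat.Properties using (<⇒<ᵇ)
open import Data.Nat.Combinatorics using (_C_; nCn≡1; k>n⇒nCk≡0; nCk+nC[k+1]≡[n+1]C[k+1])
open import Data.Nat.Divisibility using (_∣_; divides; ∣-trans; 1∣_; ∣1⇒≡1; m∣m*n; *-monoʳ-∣; *-cancelˡ-∣)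
open import Data.Nat.DivMod using (m%n<n; m≡m%n+[m/n]*n)
open import Data.Nat.Induction using (<-rec)
open import Data.Nat.Primality
  using (Prime; prime[2]; euclidsLemma; prime⇒irreducible; prime⇒nonZero; prime⇒nonTrivial)
import Data.Nat.Coprimality as Coprimality
open import Data.Integer as ℤ using (ℤ)
import Data.Integer.Properties as ℤ
open import Data.Rational using (+-*-rawSemiring; ℚ; mkℚ; 0ℚ; 1ℚ; ½; _+_; _*_; _-_; -_; _/_; toℚᵘ)
open import Data.Rational.Properties
  using ( +-0-commutativeMonoid; *-1-commutativeMonoid; toℚᵘ-injective; toℚᵘ-fromℚᵘ; toℚᵘ-homo-+; toℚᵘ-homo-*
        ; +-comm; +-assoc; *-assoc; *-comm; +-identityˡ; +-identityʳ; *-identityˡ; *-identityʳ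
        ; *-zeroˡ; *-zeroʳ; *-distribˡ-+; *-distribʳ-+; neg-distrib-+; neg-distribˡ-*; neg-distribʳ-* )
import Data.Rational.Unnormalised as ℚᵘ
import Data.Rational.Unnormalised.Properties as ℚᵘ
open import Data.Rational.Solver using (module +-*-Solver)
open import Algebra.Definitions.RawSemiring +-*-rawSemiring using (_^_)
open import Algebra.Bundles using (CommutativeMonoid)
import Algebra.Properties.CommutativeSemigroup as CommutativeSemigroupProperties
open import Relation.Nullary using (¬_; contradiction)
open import Relation.Binary.PropositionalEquality

open +-*-Solver using (solve; _:=_; _:+_; _:*_; _:-_; :-_; con)
open CommutativeSemigroupProperties (CommutativeMonoid.commutativeSemigroup +-0-commutativeMonoid)
  using () renaming (interchange to +-interchange; x∙yz≈y∙xz to +-left-swap)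
open CommutativeSemigroupProperties (CommutativeMonoid.commutativeSemigroup *-1-commutativeMonoid)
  using () renaming (interchange to *-interchange; x∙yz≈y∙xz to *-left-swap)

ℤtoℚ : ℤ → ℚ
ℤtoℚ a = a / 1

toℚᵘ-ℤtoℚ : ∀ a → toℚᵘ (ℤtoℚ a) ℚᵘ.≃ ℚᵘ.mkℚᵘ a 0
toℚᵘ-ℤtoℚ a = toℚᵘ-fromℚᵘ (ℚᵘ.mkℚᵘ a 0)

ℤtoℚ-+ : ∀ a b → ℤtoℚ (a ℤ.+ b) ≡ ℤtoℚ a + ℤtoℚ b
ℤtoℚ-+ a b = toℚᵘ-injective (begin
  toℚᵘ (ℤtoℚ (a ℤ.+ b))           ≈⟨ toℚᵘ-ℤtoℚ (a ℤ.+ b) ⟩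
  ℚᵘ.mkℚᵘ (a ℤ.+ b) 0               ≈⟨ ℚᵘ.*≡* (cong (ℤ._* ℤ.+ 1) (sym (cong₂ ℤ._+_ (ℤ.*-identityʳ a) (ℤ.*-identityʳ b)))) ⟩
  ℚᵘ.mkℚᵘ a 0 ℚᵘ.+ ℚᵘ.mkℚᵘ b 0    ≈⟨ ℚᵘ.+-cong (ℚᵘ.≃-sym (toℚᵘ-ℤtoℚ a)) (ℚᵘ.≃-sym (toℚᵘ-ℤtoℚ b)) ⟩
  toℚᵘ (ℤtoℚ a) ℚᵘ.+ toℚᵘ (ℤtoℚ b) ≈⟨ ℚᵘ.≃-sym (toℚᵘ-homo-+ (ℤtoℚ a) (ℤtoℚ b)) ⟩
  toℚᵘ (ℤtoℚ a + ℤtoℚ b)           ∎)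
  where open ℚᵘ.≃-Reasoning

ℤtoℚ-* : ∀ a b → ℤtoℚ (a ℤ.* b) ≡ ℤtoℚ a * ℤtoℚ b
ℤtoℚ-* a b = toℚᵘ-injective (begin
  toℚᵘ (ℤtoℚ (a ℤ.* b))           ≈⟨ toℚᵘ-ℤtoℚ (a ℤ.* b) ⟩
  ℚᵘ.mkℚᵘ (a ℤ.* b) 0               ≈⟨ ℚᵘ.*≡* refl ⟩
  ℚᵘ.mkℚᵘ a 0 ℚᵘ.* ℚᵘ.mkℚᵘ b 0    ≈⟨ ℚᵘ.*-cong (ℚᵘ.≃-sym (toℚᵘ-ℤtoℚ a)) (ℚᵘ.≃-sym (toℚᵘ-ℤtoℚ b)) ⟩
  toℚᵘ (ℤtoℚ a) ℚᵘ.* toℚᵘ (ℤtoℚ b) ≈⟨ ℚᵘ.≃-sym (toℚᵘ-homo-* (ℤtoℚ a) (ℤtoℚ b)) ⟩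
  toℚᵘ (ℤtoℚ a * ℤtoℚ b)           ∎)
  where open ℚᵘ.≃-Reasoning

ℕtoℚ-+ : ∀ m n → ℕtoℚ (m ℕ.+ n) ≡ ℕtoℚ m + ℕtoℚ n
ℕtoℚ-+ m n = trans (cong ℤtoℚ (ℤ.pos-+ m n)) (ℤtoℚ-+ (ℤ.+ m) (ℤ.+ n))

ℕtoℚ-* : ∀ m n → ℕtoℚ (m ℕ.* n) ≡ ℕtoℚ m * ℕtoℚ n
ℕtoℚ-* m n = trans (cong ℤtoℚ (ℤ.pos-* m n)) (ℤtoℚ-* (ℤ.+ m) (ℤ.+ n))

ℕtoℚ-suc : ∀ n → ℕtoℚ (suc n) ≡ ℕtoℚ n + 1ℚ
ℕtoℚ-suc n = trans (cong ℕtoℚ (ℕ.+-comm 1 n)) (ℕtoℚ-+ n 1)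

sumTo-cong : ∀ n {f g : ℕ → ℚ} → (∀ i → f i ≡ g i) → sumTo n f ≡ sumTo n g
sumTo-cong zero    f≗g = refl
sumTo-cong (suc n) f≗g = cong₂ _+_ (sumTo-cong n f≗g) (f≗g n)

sumTo-cong-< : ∀ n {f g : ℕ → ℚ} → (∀ i → i < n → f i ≡ g i) → sumTo n f ≡ sumTo n g
sumTo-cong-< zero    f≗g = refl
sumTo-cong-< (suc n) f≗g =
  cong₂ _+_ (sumTo-cong-< n (λ i i<n → f≗g i (ℕ.m<n⇒m<1+n i<n))) (f≗g n ℕ.≤-refl)

sumTo-zero : ∀ n {f : ℕ → ℚ} → (∀ i → f i ≡ 0ℚ) → sumTo n f ≡ 0ℚ
sumTo-zero zero    f≗0 = refl
sumTo-zero (suc n) f≗0 = cong₂ _+_ (sumTo-zero n f≗0) (f≗0 n)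

sumTo-+ : ∀ n (f g : ℕ → ℚ) → sumTo n (λ i → f i + g i) ≡ sumTo n f + sumTo n g
sumTo-+ zero    f g = refl
sumTo-+ (suc n) f g = trans (cong (_+ (f n + g n)) (sumTo-+ n f g)) (+-interchange (sumTo n f) (sumTo n g) (f n) (g n))

sumTo-*ˡ : ∀ n c (f : ℕ → ℚ) → sumTo n (λ i → c * f i) ≡ c * sumTo n f
sumTo-*ˡ zero    c f = sym (*-zeroʳ c)
sumTo-*ˡ (suc n) c f =
  trans (cong (_+ c * f n) (sumTo-*ˡ n c f)) (sym (*-distribˡ-+ c (sumTo n f) (f n)))

sumTo-neg : ∀ n (f : ℕ → ℚ) → sumTo n (λ i → - f i) ≡ - sumTo n f
sumTo-neg zero    f = refl
sumTo-neg (suc n) f =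
  trans (cong (_+ - f n) (sumTo-neg n f)) (sym (neg-distrib-+ (sumTo n f) (f n)))

sumTo-*-− : ∀ n (a f g : ℕ → ℚ) →
  sumTo n (λ i → a i * (f i - g i)) ≡ sumTo n (λ i → a i * f i) - sumTo n (λ i → a i * g i)
sumTo-*-− n a f g = begin
  sumTo n (λ i → a i * (f i - g i))             ≡⟨ sumTo-cong n (λ i → *-distribˡ-+ (a i) (f i) (- g i)) ⟩
  sumTo n (λ i → a i * f i + a i * - g i)       ≡⟨ sumTo-+ n _ _ ⟩
  sumTo n (λ i → a i * f i) + sumTo n (λ i → a i * - g i)
    ≡⟨ cong (sumTo n (λ i → a i * f i) +_) (trans (sumTo-cong n (λ i → sym (neg-distribʳ-* (a i) (g i)))) (sumTo-neg n _)) ⟩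
  sumTo n (λ i → a i * f i) - sumTo n (λ i → a i * g i) ∎
  where open ≡-Reasoning

sumTo-suc : ∀ n (f : ℕ → ℚ) → sumTo (suc n) f ≡ f 0 + sumTo n (f ∘ suc)
sumTo-suc zero    f = +-comm 0ℚ (f 0)
sumTo-suc (suc n) f =
  trans (cong (_+ f (suc n)) (sumTo-suc n f)) (+-assoc (f 0) (sumTo n (f ∘ suc)) (f (suc n)))

sumTo-swap : ∀ m n (f : ℕ → ℕ → ℚ) →
  sumTo m (λ i → sumTo n (f i)) ≡ sumTo n (λ j → sumTo m (λ i → f i j))
sumTo-swap zero    n f = sym (sumTo-zero n (λ _ → refl))
sumTo-swap (suc m) n f =
  trans (cong (_+ sumTo n (f m)) (sumTo-swap m n f)) (sym (sumTo-+ n (λ j → sumTo m (λ i → f i j)) (f m)))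

prodTo-cong : ∀ n {f g : ℕ → ℚ} → (∀ i → f i ≡ g i) → prodTo n f ≡ prodTo n g
prodTo-cong zero    f≗g = refl
prodTo-cong (suc n) f≗g = cong₂ _*_ (prodTo-cong n f≗g) (f≗g n)

prodTo-suc : ∀ n (f : ℕ → ℚ) → prodTo (suc n) f ≡ f 0 * prodTo n (f ∘ suc)
prodTo-suc zero    f = trans (*-identityˡ (f 0)) (sym (*-identityʳ (f 0)))
prodTo-suc (suc n) f =
  trans (cong (_* f (suc n)) (prodTo-suc n f)) (*-assoc (f 0) (prodTo n (f ∘ suc)) (f (suc n)))

sumTo-extend : ∀ n {f : ℕ → ℚ} → f n ≡ 0ℚ → sumTo (suc n) f ≡ sumTo n f
sumTo-extend n {f} fn≡0 = trans (cong (sumTo n f +_) fn≡0) (+-identityʳ (sumTo n f))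

binomial : ∀ k x → (x + 1ℚ) ^ k ≡ sumTo (suc k) (λ j → ℕtoℚ (k C j) * x ^ j)
binomial zero    x = refl
binomial (suc k) x = begin
  (x + 1ℚ) * (x + 1ℚ) ^ k                      ≡⟨ cong ((x + 1ℚ) *_) (binomial k x) ⟩
  (x + 1ℚ) * sumTo (suc k) (term k)            ≡⟨ *-distribʳ-+ (sumTo (suc k) (term k)) x 1ℚ ⟩
  x * sumTo (suc k) (term k) + 1ℚ * sumTo (suc k) (term k)
    ≡⟨ cong₂ _+_ (sym (sumTo-*ˡ (suc k) x (term k))) (*-identityˡ (sumTo (suc k) (term k))) ⟩
  sumTo (suc k) (λ j → x * term k j) + sumTo (suc k) (term k)
    ≡⟨ cong₂ _+_ (sumTo-cong (suc k) x*term) (sumTo-suc k (term k)) ⟩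
  sumTo (suc k) raised + (1ℚ + sumTo k (term k ∘ suc))
    ≡⟨ cong (λ s → sumTo (suc k) raised + (1ℚ + s)) (sym (sumTo-extend k (top-vanishes k))) ⟩
  sumTo (suc k) raised + (1ℚ + sumTo (suc k) (term k ∘ suc))
    ≡⟨ +-left-swap (sumTo (suc k) raised) 1ℚ (sumTo (suc k) (term k ∘ suc)) ⟩
  1ℚ + (sumTo (suc k) raised + sumTo (suc k) (term k ∘ suc))
    ≡⟨ cong (1ℚ +_) (sym (sumTo-+ (suc k) raised (term k ∘ suc))) ⟩
  1ℚ + sumTo (suc k) (λ j → raised j + term k (suc j))
    ≡⟨ cong (1ℚ +_) (sumTo-cong (suc k) pascal) ⟩
  1ℚ + sumTo (suc k) (term (suc k) ∘ suc)     ≡⟨ sym (sumTo-suc (suc k) (term (suc k))) ⟩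
  sumTo (suc (suc k)) (term (suc k))           ∎
  where
  open ≡-Reasoning
  term : ℕ → ℕ → ℚ
  term n j = ℕtoℚ (n C j) * x ^ j

  raised : ℕ → ℚ
  raised j = ℕtoℚ (k C j) * x ^ suc j

  x*term : ∀ j → x * term k j ≡ raised j
  x*term j = *-left-swap x (ℕtoℚ (k C j)) (x ^ j)

  top-vanishes : ∀ n → term n (suc n) ≡ 0ℚ
  top-vanishes n = trans (cong (λ c → ℕtoℚ c * x ^ suc n) (k>n⇒nCk≡0 (ℕ.n<1+n n))) (*-zeroˡ (x ^ suc n))

  pascal : ∀ j → raised j + term k (suc j) ≡ term (suc k) (suc j)
  pascal j = begin
    ℕtoℚ (k C j) * x ^ suc j + ℕtoℚ (k C suc j) * x ^ suc j ≡⟨ sym (*-distribʳ-+ (x ^ suc j) (ℕtoℚ (k C j)) (ℕtoℚ (k C suc j))) ⟩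
    (ℕtoℚ (k C j) + ℕtoℚ (k C suc j)) * x ^ suc j           ≡⟨ cong (_* x ^ suc j) (sym (ℕtoℚ-+ (k C j) (k C suc j))) ⟩
    ℕtoℚ (k C j ℕ.+ k C suc j) * x ^ suc j                   ≡⟨ cong (λ c → ℕtoℚ c * x ^ suc j) (nCk+nC[k+1]≡[n+1]C[k+1] k j) ⟩
    ℕtoℚ (suc k C suc j) * x ^ suc j                         ∎

alternatingSum : ℕ → (ℕ → ℚ) → ℚ
alternatingSum M f = sumTo M (λ x → sgn x * f x)

alternatingSum-telescope : ∀ M (f : ℕ → ℚ) →
  alternatingSum M (f ∘ suc) + alternatingSum M f ≡ f 0 - sgn M * f M
alternatingSum-telescope zero    f = cancel (f 0)
  where
  cancel : ∀ a → 0ℚ + 0ℚ ≡ a - 1ℚ * a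
  cancel = solve 1 (λ a → con 0ℚ :+ con 0ℚ := a :- con 1ℚ :* a) refl
alternatingSum-telescope (suc M) f = begin
  (alternatingSum M (f ∘ suc) + sgn M * f (suc M)) + (alternatingSum M f + sgn M * f M)
    ≡⟨ +-interchange (alternatingSum M (f ∘ suc)) (sgn M * f (suc M)) (alternatingSum M f) (sgn M * f M) ⟩
  (alternatingSum M (f ∘ suc) + alternatingSum M f) + (sgn M * f (suc M) + sgn M * f M)
    ≡⟨ cong (_+ (sgn M * f (suc M) + sgn M * f M)) (alternatingSum-telescope M f) ⟩
  (f 0 - sgn M * f M) + (sgn M * f (suc M) + sgn M * f M)
    ≡⟨ telescoped (f 0) (sgn M) (f (suc M)) (f M) ⟩
  f 0 - sgn (suc M) * f (suc M) ∎
  where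
  open ≡-Reasoning
  telescoped : ∀ a s b c → (a - s * c) + (s * b + s * c) ≡ a - (- s) * b
  telescoped = solve 4 (λ a s b c → (a :- s :* c) :+ (s :* b :+ s :* c) := a :- (:- s) :* b) refl

altPowerSum : ℕ → ℕ → ℚ
altPowerSum M k = alternatingSum M (λ x → ℕtoℚ x ^ k)

alternatingSum-polynomial : ∀ M d (a : ℕ → ℚ) →
  alternatingSum M (λ x → sumTo d (λ j → a j * ℕtoℚ x ^ j)) ≡ sumTo d (λ j → a j * altPowerSum M j)
alternatingSum-polynomial M d a = begin
  sumTo M (λ x → sgn x * sumTo d (λ j → a j * ℕtoℚ x ^ j))
    ≡⟨ sumTo-cong M (λ x → trans (sym (sumTo-*ˡ d (sgn x) _)) (sumTo-cong d (λ j → *-left-swap (sgn x) (a j) _))) ⟩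
  sumTo M (λ x → sumTo d (λ j → a j * (sgn x * ℕtoℚ x ^ j)))   ≡⟨ sumTo-swap M d _ ⟩
  sumTo d (λ j → sumTo M (λ x → a j * (sgn x * ℕtoℚ x ^ j)))   ≡⟨ sumTo-cong d (λ j → sumTo-*ˡ M (a j) _) ⟩
  sumTo d (λ j → a j * altPowerSum M j)                        ∎
  where open ≡-Reasoning

altPowerSum-binomial : ∀ M → sgn M ≡ - 1ℚ → ∀ k →
  sumTo (suc k) (λ j → ℕtoℚ (k C j) * altPowerSum M j) + altPowerSum M k ≡ 0ℚ ^ k + ℕtoℚ M ^ k
altPowerSum-binomial M sgnM k = begin
  sumTo (suc k) (λ j → ℕtoℚ (k C j) * altPowerSum M j) + altPowerSum M k
    ≡⟨ cong (_+ altPowerSum M k) (sym (alternatingSum-polynomial M (suc k) (λ j → ℕtoℚ (k C j)))) ⟩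
  alternatingSum M (λ x → sumTo (suc k) (λ j → ℕtoℚ (k C j) * ℕtoℚ x ^ j)) + altPowerSum M k
    ≡⟨ cong (λ s → s + altPowerSum M k) (sumTo-cong M (λ x → cong (sgn x *_) (sym (shifted-power x)))) ⟩
  alternatingSum M (power ∘ suc) + alternatingSum M power ≡⟨ alternatingSum-telescope M power ⟩
  0ℚ ^ k - sgn M * ℕtoℚ M ^ k                           ≡⟨ cong (λ s → 0ℚ ^ k - s * ℕtoℚ M ^ k) sgnM ⟩
  0ℚ ^ k - (- 1ℚ) * ℕtoℚ M ^ k                          ≡⟨ minus-minus (0ℚ ^ k) (ℕtoℚ M ^ k) ⟩
  0ℚ ^ k + ℕtoℚ M ^ k                                    ∎
  where
  open ≡-Reasoning
  power : ℕ → ℚ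
  power x = ℕtoℚ x ^ k
  shifted-power : ∀ x → power (suc x) ≡ sumTo (suc k) (λ j → ℕtoℚ (k C j) * ℕtoℚ x ^ j)
  shifted-power x = trans (cong (_^ k) (ℕtoℚ-suc x)) (binomial k (ℕtoℚ x))
  minus-minus : ∀ a b → a - (- 1ℚ) * b ≡ a + b
  minus-minus = solve 2 (λ a b → a :- (:- con 1ℚ) :* b := a :+ b) refl

<ᵇ-irrefl : ∀ n → (n <ᵇ n) ≡ false
<ᵇ-irrefl zero    = refl
<ᵇ-irrefl (suc n) = <ᵇ-irrefl n

eTable-stable : ∀ {n j} → j ≤ n → eTable (suc n) j ≡ E j
eTable-stable j≤n with ℕ.m≤n⇒m<n∨m≡n j≤n
... | inj₂ refl          = refl
... | inj₁ j<n@(s≤s j≤m) = trans (if-cong (Equivalence.to T-≡ (<⇒<ᵇ j<n))) (eTable-stable j≤m)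

E-suc : ∀ n → E (suc n) ≡ - (½ * sumTo (suc n) (λ j → ℕtoℚ (suc n C j) * E j))
E-suc n = trans (if-cong (<ᵇ-irrefl n))
  (cong (λ s → - (½ * s)) (sumTo-cong-< (suc n) λ { j (s≤s j≤n) → cong (ℕtoℚ (suc n C j) *_) (eTable-stable j≤n) }))

eulerDefect : ℕ → ℕ → ℚ
eulerDefect M k = altPowerSum M k - E k

module _ (M : ℕ) (sgnM : sgn M ≡ - 1ℚ) where

  eulerDefect-zero : eulerDefect M 0 ≡ 0ℚ
  eulerDefect-zero = begin
    altPowerSum M 0 - 1ℚ                                        ≡⟨ halve (altPowerSum M 0) ⟩
    ½ * ((0ℚ + 1ℚ * altPowerSum M 0) + altPowerSum M 0) - 1ℚ    ≡⟨ cong (λ s → ½ * s - 1ℚ) (altPowerSum-binomial M sgnM 0) ⟩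
    ½ * (1ℚ + 1ℚ) - 1ℚ                                          ≡⟨⟩
    0ℚ                                                          ∎
    where
    open ≡-Reasoning
    halve : ∀ s → s - 1ℚ ≡ ½ * ((0ℚ + 1ℚ * s) + s) - 1ℚ
    halve = solve 1 (λ s → s :- con 1ℚ := con ½ :* ((con 0ℚ :+ con 1ℚ :* s) :+ s) :- con 1ℚ) refl

  eulerDefect-suc : ∀ k → eulerDefect M (suc k) ≡
    ½ * (ℕtoℚ M ^ suc k - sumTo (suc k) (λ j → ℕtoℚ (suc k C j) * eulerDefect M j))
  eulerDefect-suc k = begin
    S (suc k) - E (suc k)                       ≡⟨ cong (λ e → S (suc k) - e) (E-suc k) ⟩
    S (suc k) - - (½ * weighted E)              ≡⟨ halve (S (suc k)) (weighted S) (weighted E) ⟩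
    ½ * ((weighted S + 1ℚ * S (suc k) + S (suc k)) - (weighted S - weighted E))
      ≡⟨ cong (λ s → ½ * (s - (weighted S - weighted E))) doubled ⟩
    ½ * (ℕtoℚ M ^ suc k - (weighted S - weighted E))
      ≡⟨ cong (λ s → ½ * (ℕtoℚ M ^ suc k - s)) (sym (sumTo-*-− (suc k) (λ j → ℕtoℚ (suc k C j)) S E)) ⟩
    ½ * (ℕtoℚ M ^ suc k - sumTo (suc k) (λ j → ℕtoℚ (suc k C j) * eulerDefect M j)) ∎
    where
    open ≡-Reasoning
    S : ℕ → ℚ
    S = altPowerSum M
    weighted : (ℕ → ℚ) → ℚ
    weighted f = sumTo (suc k) (λ j → ℕtoℚ (suc k C j) * f j)
    halve : ∀ s a b → s - - (½ * b) ≡ ½ * ((a + 1ℚ * s + s) - (a - b))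
    halve = solve 3 (λ s a b → s :- :- (con ½ :* b) := con ½ :* ((a :+ con 1ℚ :* s :+ s) :- (a :- b))) refl
    doubled : weighted S + 1ℚ * S (suc k) + S (suc k) ≡ ℕtoℚ M ^ suc k
    doubled = begin
      weighted S + 1ℚ * S (suc k) + S (suc k)
        ≡⟨ cong (λ c → weighted S + ℕtoℚ c * S (suc k) + S (suc k)) (sym (nCn≡1 (suc k))) ⟩
      weighted S + ℕtoℚ (suc k C suc k) * S (suc k) + S (suc k) ≡⟨ altPowerSum-binomial M sgnM (suc k) ⟩
      0ℚ * 0ℚ ^ k + ℕtoℚ M ^ suc k ≡⟨ cong (_+ ℕtoℚ M ^ suc k) (*-zeroˡ (0ℚ ^ k)) ⟩
      0ℚ + ℕtoℚ M ^ suc k ≡⟨ +-identityˡ (ℕtoℚ M ^ suc k) ⟩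
      ℕtoℚ M ^ suc k ∎

coeff-addP : ∀ q r k → coeff (addP q r) k ≡ coeff q k + coeff r k
coeff-addP []       r        k       = sym (+-identityˡ (coeff r k))
coeff-addP (a ∷ as) []       k       = sym (+-identityʳ (coeff (a ∷ as) k))
coeff-addP (a ∷ as) (b ∷ bs) zero    = refl
coeff-addP (a ∷ as) (b ∷ bs) (suc k) = coeff-addP as bs k

coeff-scale : ∀ c q k → coeff (scale c q) k ≡ c * coeff q k
coeff-scale c []       k       = sym (*-zeroʳ c)
coeff-scale c (a ∷ as) zero    = refl
coeff-scale c (a ∷ as) (suc k) = coeff-scale c as k

DegreeBelow : ℕ → Poly → Set
DegreeBelow d q = ∀ k → d ≤ k → coeff q k ≡ 0ℚ

mulLin-degreeBelow : ∀ {d} c q → DegreeBelow d q → DegreeBelow (suc d) (mulLin c q)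
mulLin-degreeBelow c q deg (suc k) (s≤s d≤k) = begin
  coeff (addP (mulX q) (scale c q)) (suc k)  ≡⟨ coeff-addP (mulX q) (scale c q) (suc k) ⟩
  coeff q k + coeff (scale c q) (suc k)      ≡⟨ cong (coeff q k +_) (coeff-scale c q (suc k)) ⟩
  coeff q k + c * coeff q (suc k)            ≡⟨ cong₂ (λ a b → a + c * b) (deg k d≤k) (deg (suc k) (ℕ.m≤n⇒m≤1+n d≤k)) ⟩
  0ℚ + c * 0ℚ                                ≡⟨ cong (0ℚ +_) (*-zeroʳ c) ⟩
  0ℚ                                         ∎
  where open ≡-Reasoning

prodLinTo-degreeBelow : ∀ m c → DegreeBelow (suc m) (prodLinTo m c)
prodLinTo-degreeBelow zero    c (suc k) _ = refl
prodLinTo-degreeBelow (suc m) c = mulLin-degreeBelow (c m) (prodLinTo m c) (prodLinTo-degreeBelow m c)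

eval : ℕ → Poly → ℚ → ℚ
eval d q x = sumTo d (λ k → coeff q k * x ^ k)

eval-addP : ∀ d q r x → eval d (addP q r) x ≡ eval d q x + eval d r x
eval-addP d q r x = trans
  (sumTo-cong d (λ k → trans (cong (_* x ^ k) (coeff-addP q r k)) (*-distribʳ-+ (x ^ k) (coeff q k) (coeff r k))))
  (sumTo-+ d _ _)

eval-scale : ∀ d c q x → eval d (scale c q) x ≡ c * eval d q x
eval-scale d c q x = trans
  (sumTo-cong d (λ k → trans (cong (_* x ^ k) (coeff-scale c q k)) (*-assoc c (coeff q k) (x ^ k))))
  (sumTo-*ˡ d c _)

eval-mulX : ∀ d q x → eval (suc d) (mulX q) x ≡ x * eval d q x
eval-mulX d q x = begin
  eval (suc d) (mulX q) x                        ≡⟨ sumTo-suc d _ ⟩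
  0ℚ + sumTo d (λ k → coeff q k * (x * x ^ k))   ≡⟨ +-identityˡ _ ⟩
  sumTo d (λ k → coeff q k * (x * x ^ k))        ≡⟨ sumTo-cong d (λ k → *-left-swap (coeff q k) x (x ^ k)) ⟩
  sumTo d (λ k → x * (coeff q k * x ^ k))        ≡⟨ sumTo-*ˡ d x _ ⟩
  x * eval d q x                                 ∎
  where open ≡-Reasoning

eval-degreeBelow : ∀ {d} q x → DegreeBelow d q → eval (suc d) q x ≡ eval d q x
eval-degreeBelow {d} q x deg = sumTo-extend d (trans (cong (_* x ^ d) (deg d ℕ.≤-refl)) (*-zeroˡ (x ^ d)))

eval-mulLin : ∀ {d} c q x → DegreeBelow d q → eval (suc d) (mulLin c q) x ≡ (x + c) * eval d q x
eval-mulLin {d} c q x deg = begin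
  eval (suc d) (addP (mulX q) (scale c q)) x             ≡⟨ eval-addP (suc d) (mulX q) (scale c q) x ⟩
  eval (suc d) (mulX q) x + eval (suc d) (scale c q) x   ≡⟨ cong₂ _+_ (eval-mulX d q x) (eval-scale (suc d) c q x) ⟩
  x * eval d q x + c * eval (suc d) q x                  ≡⟨ cong (λ e → x * eval d q x + c * e) (eval-degreeBelow q x deg) ⟩
  x * eval d q x + c * eval d q x                        ≡⟨ sym (*-distribʳ-+ (eval d q x) x c) ⟩
  (x + c) * eval d q x                                   ∎
  where open ≡-Reasoning

eval-prodLinTo : ∀ m c x → eval (suc m) (prodLinTo m c) x ≡ prodTo m (λ i → x + c i)
eval-prodLinTo zero    c x = refl
eval-prodLinTo (suc m) c x = begin
  eval (suc (suc m)) (mulLin (c m) (prodLinTo m c)) x   ≡⟨ eval-mulLin (c m) (prodLinTo m c) x (prodLinTo-degreeBelow m c) ⟩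
  (x + c m) * eval (suc m) (prodLinTo m c) x            ≡⟨ cong ((x + c m) *_) (eval-prodLinTo m c x) ⟩
  (x + c m) * prodTo m (λ i → x + c i)                  ≡⟨ *-comm (x + c m) _ ⟩
  prodTo (suc m) (λ i → x + c i)                        ∎
  where open ≡-Reasoning

cfac-eval : ∀ n x → cfac n x ≡ sumTo (suc n) (λ k → t n k * x ^ k)
cfac-eval zero    x = refl
cfac-eval (suc m) x = sym (begin
  eval (suc (suc m)) (mulX (prodLinTo m offset)) x       ≡⟨ eval-mulX (suc m) (prodLinTo m offset) x ⟩
  x * eval (suc m) (prodLinTo m offset) x                ≡⟨ cong (x *_) (eval-prodLinTo m offset x) ⟩
  x * prodTo m (λ i → x + offset i)                      ≡⟨ cong (x *_) (prodTo-cong m (λ i → sym (+-assoc x _ _))) ⟩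
  cfac (suc m) x                                         ∎)
  where
  open ≡-Reasoning
  offset : ℕ → ℚ
  offset i = ℕtoℚ (suc m) * ½ - ℕtoℚ (suc i)

cfacFactor : ℕ → ℚ → ℕ → ℚ
cfacFactor n x i = x + ℕtoℚ n * ½ - ℕtoℚ (suc i)

module _ (n : ℕ) (x : ℚ) where

  private
    ℕtoℚ-2+ : ℕtoℚ (suc (suc n)) ≡ ℕtoℚ n + 1ℚ + 1ℚ
    ℕtoℚ-2+ = trans (ℕtoℚ-suc (suc n)) (cong (_+ 1ℚ) (ℕtoℚ-suc n))

  cfacFactor-first : cfacFactor (suc (suc n)) x 0 ≡ x + ℕtoℚ n * ½
  cfacFactor-first = trans (cong (λ a → x + a * ½ - ℕtoℚ 1) ℕtoℚ-2+) (identity x (ℕtoℚ n))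
    where
    identity : ∀ x a → x + (a + 1ℚ + 1ℚ) * ½ - ℕtoℚ 1 ≡ x + a * ½
    identity = solve 2 (λ x a → x :+ (a :+ con 1ℚ :+ con 1ℚ) :* con ½ :- con (ℕtoℚ 1) := x :+ a :* con ½) refl

  cfacFactor-last : cfacFactor (suc (suc n)) x n ≡ x - ℕtoℚ n * ½
  cfacFactor-last = trans (cong₂ (λ a b → x + a * ½ - b) ℕtoℚ-2+ (ℕtoℚ-suc n)) (identity x (ℕtoℚ n))
    where
    identity : ∀ x a → x + (a + 1ℚ + 1ℚ) * ½ - (a + 1ℚ) ≡ x - a * ½
    identity = solve 2 (λ x a → x :+ (a :+ con 1ℚ :+ con 1ℚ) :* con ½ :- (a :+ con 1ℚ) := x :- a :* con ½) refl

  cfacFactor-suc : ∀ i → cfacFactor (suc (suc n)) x (suc i) ≡ cfacFactor n x i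
  cfacFactor-suc i = trans (cong₂ (λ a b → x + a * ½ - b) ℕtoℚ-2+ (ℕtoℚ-suc (suc i))) (identity x (ℕtoℚ n) (ℕtoℚ (suc i)))
    where
    identity : ∀ x a b → x + (a + 1ℚ + 1ℚ) * ½ - (b + 1ℚ) ≡ x + a * ½ - b
    identity = solve 3 (λ x a b → x :+ (a :+ con 1ℚ :+ con 1ℚ) :* con ½ :- (b :+ con 1ℚ) := x :+ a :* con ½ :- b) refl

cfac-step : ∀ n x → x * x * cfac n x ≡ cfac (suc (suc n)) x + (ℕtoℚ n * ½) * (ℕtoℚ n * ½) * cfac n x
cfac-step zero    x = identity x
  where
  identity : ∀ x → x * x * 1ℚ ≡ x * (1ℚ * (x + ℕtoℚ 2 * ½ - ℕtoℚ 1)) + (ℕtoℚ 0 * ½) * (ℕtoℚ 0 * ½) * 1ℚ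
  identity = solve 1 (λ x → x :* x :* con 1ℚ
    := x :* (con 1ℚ :* (x :+ con (ℕtoℚ 2) :* con ½ :- con (ℕtoℚ 1))) :+ (con (ℕtoℚ 0) :* con ½) :* (con (ℕtoℚ 0) :* con ½) :* con 1ℚ) refl
cfac-step n@(suc m) x = begin
  x * x * (x * Q)                                  ≡⟨ difference-of-squares x c Q ⟩
  x * (((x + c) * Q) * (x - c)) + c * c * (x * Q)  ≡⟨ cong (_+ c * c * (x * Q)) (sym expand) ⟩
  cfac (suc (suc n)) x + c * c * (x * Q)           ∎
  where
  open ≡-Reasoning
  c : ℚ
  c = ℕtoℚ n * ½
  Q : ℚ
  Q = prodTo m (cfacFactor n x)
  difference-of-squares : ∀ x c Q → x * x * (x * Q) ≡ x * (((x + c) * Q) * (x - c)) + c * c * (x * Q)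
  difference-of-squares = solve 3 (λ x c Q → x :* x :* (x :* Q) := x :* (((x :+ c) :* Q) :* (x :- c)) :+ c :* c :* (x :* Q)) refl
  expand : cfac (suc (suc n)) x ≡ x * (((x + c) * Q) * (x - c))
  expand = cong (x *_) (cong₂ _*_
    (trans (prodTo-suc m (cfacFactor (suc (suc n)) x))
           (cong₂ _*_ (cfacFactor-first n x) (prodTo-cong m (cfacFactor-suc n x))))
    (cfacFactor-last n x))

sgn-even : ∀ q → sgn (q ℕ.* 2) ≡ 1ℚ
sgn-even zero    = refl
sgn-even (suc q) = trans (double-negation (sgn (q ℕ.* 2))) (sgn-even q)
  where
  double-negation : ∀ a → - - a ≡ a
  double-negation = solve 1 (λ a → :- :- a := a) refl

sgn-odd : ∀ {n} → ¬ 2 ∣ n → sgn n ≡ - 1ℚ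
sgn-odd {n} 2∤n with n % 2 | m%n<n n 2 | m≡m%n+[m/n]*n n 2
... | 0           | _               | n≡ = contradiction (divides (n ℕ./ 2) n≡) 2∤n
... | 1           | _               | n≡ = subst (λ m → sgn m ≡ - 1ℚ) (sym n≡) (cong -_ (sgn-even (n ℕ./ 2)))
... | suc (suc _) | s≤s (s≤s ())    | _

module _ {p : ℕ} (p-prime : Prime p) where

  private instance
    p-nonZero : ℕ.NonZero p
    p-nonZero = prime⇒nonZero p-prime

  p∤1 : ¬ p ∣ 1
  p∤1 p∣1 = ℕ.<⇒≢ (ℕ.nonTrivial⇒n>1 p {{prime⇒nonTrivial p-prime}}) (sym (∣1⇒≡1 p∣1))

  p∤-* : ∀ {a b} → ¬ p ∣ a → ¬ p ∣ b → ¬ p ∣ a ℕ.* b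
  p∤-* {a} {b} p∤a p∤b p∣ab with euclidsLemma a b p-prime p∣ab
  ... | inj₁ p∣a = p∤a p∣a
  ... | inj₂ p∣b = p∤b p∣b

  record Integral (r : ℚ) : Set where
    constructor integral
    field
      denominator   : ℕ
      p∤denominator : ¬ p ∣ denominator
      numerator     : ℤ
      cleared       : r * ℕtoℚ denominator ≡ ℤtoℚ numerator

  integral-ℤtoℚ : ∀ a → Integral (ℤtoℚ a)
  integral-ℤtoℚ a = integral 1 p∤1 a (*-identityʳ (ℤtoℚ a))

  integral-ℕtoℚ : ∀ n → Integral (ℕtoℚ n)
  integral-ℕtoℚ n = integral-ℤtoℚ (ℤ.+ n)

  integral-+ : ∀ {r s} → Integral r → Integral s → Integral (r + s)
  integral-+ {r} {s} (integral b p∤b a rb≡a) (integral d p∤d c sd≡c) = integral (b ℕ.* d) (p∤-* p∤b p∤d) (a ℤ.* ℤ.+ d ℤ.+ c ℤ.* ℤ.+ b) (begin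
    (r + s) * ℕtoℚ (b ℕ.* d)                       ≡⟨ cong ((r + s) *_) (ℕtoℚ-* b d) ⟩
    (r + s) * (ℕtoℚ b * ℕtoℚ d)                    ≡⟨ cross-multiply r s (ℕtoℚ b) (ℕtoℚ d) ⟩
    (r * ℕtoℚ b) * ℕtoℚ d + (s * ℕtoℚ d) * ℕtoℚ b  ≡⟨ cong₂ (λ u v → u * ℕtoℚ d + v * ℕtoℚ b) rb≡a sd≡c ⟩
    ℤtoℚ a * ℕtoℚ d + ℤtoℚ c * ℕtoℚ b              ≡⟨ sym (cong₂ _+_ (ℤtoℚ-* a (ℤ.+ d)) (ℤtoℚ-* c (ℤ.+ b))) ⟩
    ℤtoℚ (a ℤ.* ℤ.+ d) + ℤtoℚ (c ℤ.* ℤ.+ b)        ≡⟨ sym (ℤtoℚ-+ (a ℤ.* ℤ.+ d) (c ℤ.* ℤ.+ b)) ⟩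
    ℤtoℚ (a ℤ.* ℤ.+ d ℤ.+ c ℤ.* ℤ.+ b)             ∎)
    where
    open ≡-Reasoning
    cross-multiply : ∀ r s b d → (r + s) * (b * d) ≡ (r * b) * d + (s * d) * b
    cross-multiply = solve 4 (λ r s b d → (r :+ s) :* (b :* d) := (r :* b) :* d :+ (s :* d) :* b) refl

  integral-* : ∀ {r s} → Integral r → Integral s → Integral (r * s)
  integral-* {r} {s} (integral b p∤b a rb≡a) (integral d p∤d c sd≡c) = integral (b ℕ.* d) (p∤-* p∤b p∤d) (a ℤ.* c) (begin
    (r * s) * ℕtoℚ (b ℕ.* d)         ≡⟨ cong ((r * s) *_) (ℕtoℚ-* b d) ⟩
    (r * s) * (ℕtoℚ b * ℕtoℚ d)      ≡⟨ *-interchange r s (ℕtoℚ b) (ℕtoℚ d) ⟩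
    (r * ℕtoℚ b) * (s * ℕtoℚ d)      ≡⟨ cong₂ _*_ rb≡a sd≡c ⟩
    ℤtoℚ a * ℤtoℚ c                  ≡⟨ sym (ℤtoℚ-* a c) ⟩
    ℤtoℚ (a ℤ.* c)                   ∎)
    where
    open ≡-Reasoning

  integral-^ : ∀ {r} k → Integral r → Integral (r ^ k)
  integral-^ zero    _ = integral-ℕtoℚ 1
  integral-^ (suc k) z = integral-* z (integral-^ k z)

  integral-coeff-mulLin : ∀ {c} q → Integral c → (∀ k → Integral (coeff q k)) → ∀ k → Integral (coeff (mulLin c q) k)
  integral-coeff-mulLin {c} q zc zq k =
    subst Integral (sym (trans (coeff-addP (mulX q) (scale c q) k) (cong (coeff (mulX q) k +_) (coeff-scale c q k))))
      (integral-+ (shifted k) (integral-* zc (zq k)))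
    where
    shifted : ∀ k → Integral (coeff (mulX q) k)
    shifted zero    = integral-ℕtoℚ 0
    shifted (suc k) = zq k

  integral-coeff-prodLinTo : ∀ m {c} → (∀ i → Integral (c i)) → ∀ k → Integral (coeff (prodLinTo m c) k)
  integral-coeff-prodLinTo zero    zc zero    = integral-ℕtoℚ 1
  integral-coeff-prodLinTo zero    zc (suc k) = integral-ℕtoℚ 0
  integral-coeff-prodLinTo (suc m) zc = integral-coeff-mulLin (prodLinTo m _) (zc m) (integral-coeff-prodLinTo m zc)

  record MultipleOf (M : ℕ) (q : ℚ) : Set where
    constructor multiple
    field
      {quotient}        : ℚ
      integral-quotient : Integral quotient
      factorisation     : q ≡ ℕtoℚ M * quotient

  multipleOf-0 : ∀ {M} → MultipleOf M 0ℚ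
  multipleOf-0 {M} = multiple (integral-ℕtoℚ 0) (sym (*-zeroʳ (ℕtoℚ M)))

  multipleOf-* : ∀ {M r} → Integral r → MultipleOf M (ℕtoℚ M * r)
  multipleOf-* zr = multiple zr refl

  multipleOf-+ : ∀ {M q q′} → MultipleOf M q → MultipleOf M q′ → MultipleOf M (q + q′)
  multipleOf-+ {M} (multiple {r} zr refl) (multiple {r′} zr′ refl) = multiple (integral-+ zr zr′) (sym (*-distribˡ-+ (ℕtoℚ M) r r′))

  multipleOf-*ˡ : ∀ {M c q} → Integral c → MultipleOf M q → MultipleOf M (c * q)
  multipleOf-*ˡ {M} {c} zc (multiple {r} zr refl) = multiple (integral-* zc zr) (*-left-swap c (ℕtoℚ M) r)

  multipleOf-− : ∀ {M q q′} → MultipleOf M q → MultipleOf M q′ → MultipleOf M (q - q′)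
  multipleOf-− {M} {q} {q′} mq mq′ = multipleOf-+ mq (subst (MultipleOf M) negate (multipleOf-*ˡ (integral-ℤtoℚ ℤ.-[1+ 0 ]) mq′))
    where
    negate : - 1ℚ * q′ ≡ - q′
    negate = trans (sym (neg-distribˡ-* 1ℚ q′)) (cong -_ (*-identityˡ q′))

  multipleOf-sumTo : ∀ {M} n {f : ℕ → ℚ} → (∀ i → i < n → MultipleOf M (f i)) → MultipleOf M (sumTo n f)
  multipleOf-sumTo zero    mf = multipleOf-0
  multipleOf-sumTo (suc n) mf = multipleOf-+ (multipleOf-sumTo n (λ i i<n → mf i (ℕ.m<n⇒m<1+n i<n))) (mf n ℕ.≤-refl)

  pow-∣-cancelʳ : ∀ {b} → ¬ p ∣ b → ∀ m x → p ℕ.^ m ∣ x ℕ.* b → p ℕ.^ m ∣ x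
  pow-∣-cancelʳ p∤b zero    x _ = 1∣ x
  pow-∣-cancelʳ {b} p∤b (suc m) x pᵐ⁺¹∣xb with euclidsLemma x b p-prime (∣-trans (m∣m*n (p ℕ.^ m)) pᵐ⁺¹∣xb)
  ... | inj₂ p∣b = contradiction p∣b p∤b
  ... | inj₁ (divides y refl) = subst (p ℕ.^ suc m ∣_) (ℕ.*-comm p y) (*-monoʳ-∣ p (pow-∣-cancelʳ p∤b m y pᵐ∣yb))
    where
    pᵐ∣yb : p ℕ.^ m ∣ y ℕ.* b
    pᵐ∣yb = *-cancelˡ-∣ p (subst (p ℕ.^ suc m ∣_) regroup pᵐ⁺¹∣xb)
      where
      regroup : y ℕ.* p ℕ.* b ≡ p ℕ.* (y ℕ.* b)
      regroup = trans (cong (ℕ._* b) (ℕ.*-comm y p)) (ℕ.*-assoc p y b)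

  padicSmall-of-cleared : ∀ m q b a → ¬ p ∣ b → q * ℕtoℚ b ≡ ℤtoℚ (ℤ.+ (p ℕ.^ m) ℤ.* a) → padicSmall p m q
  padicSmall-of-cleared m q@(mkℚ num d-1 coprime) b a p∤b qb≡pᵐa = p∤denominator , pᵐ∣numerator
    where
    open ℚᵘ.≃-Reasoning
    den : ℕ
    den = suc d-1
    z : ℤ
    z = ℤ.+ (p ℕ.^ m) ℤ.* a
    unnormalised : ℚᵘ.mkℚᵘ num d-1 ℚᵘ.* ℚᵘ.mkℚᵘ (ℤ.+ b) 0 ℚᵘ.≃ ℚᵘ.mkℚᵘ z 0
    unnormalised = begin
      ℚᵘ.mkℚᵘ num d-1 ℚᵘ.* ℚᵘ.mkℚᵘ (ℤ.+ b) 0 ≈⟨ ℚᵘ.*-cong ℚᵘ.≃-refl (ℚᵘ.≃-sym (toℚᵘ-ℤtoℚ (ℤ.+ b))) ⟩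
      toℚᵘ q ℚᵘ.* toℚᵘ (ℕtoℚ b)               ≈⟨ ℚᵘ.≃-sym (toℚᵘ-homo-* q (ℕtoℚ b)) ⟩
      toℚᵘ (q * ℕtoℚ b)                       ≈⟨ ℚᵘ.≃-reflexive (cong toℚᵘ qb≡pᵐa) ⟩
      toℚᵘ (ℤtoℚ z)                           ≈⟨ toℚᵘ-ℤtoℚ z ⟩
      ℚᵘ.mkℚᵘ z 0                             ∎
    integer-equation : num ℤ.* ℤ.+ b ≡ z ℤ.* ℤ.+ den
    integer-equation with unnormalised
    ... | ℚᵘ.*≡* eq = trans (sym (ℤ.*-identityʳ (num ℤ.* ℤ.+ b))) (trans eq (cong (λ d → z ℤ.* ℤ.+ d) (ℕ.*-identityʳ den)))
    natural-equation : ℤ.∣ num ∣ ℕ.* b ≡ (p ℕ.^ m ℕ.* ℤ.∣ a ∣) ℕ.* den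
    natural-equation = trans (sym (ℤ.abs-* num (ℤ.+ b)))
      (trans (cong ℤ.∣_∣ integer-equation) (trans (ℤ.abs-* z (ℤ.+ den)) (cong (ℕ._* den) (ℤ.abs-* (ℤ.+ (p ℕ.^ m)) a))))
    den∣b : den ∣ b
    den∣b = Coprimality.coprime-divisor (Coprimality.sym (Coprimality.recompute coprime))
      (subst (den ∣_) (sym natural-equation) (divides (p ℕ.^ m ℕ.* ℤ.∣ a ∣) refl))
    p∤denominator : ¬ p ∣ den
    p∤denominator p∣den = p∤b (∣-trans p∣den den∣b)
    pᵐ∣numerator : p ℕ.^ m ∣ ℤ.∣ num ∣
    pᵐ∣numerator = pow-∣-cancelʳ p∤b m ℤ.∣ num ∣
      (subst (p ℕ.^ m ∣_) (sym natural-equation) (∣-trans (m∣m*n ℤ.∣ a ∣) (m∣m*n den)))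

  multipleOf-pow⇒padicSmall : ∀ {m N q} → m ≤ N → MultipleOf (p ℕ.^ N) q → padicSmall p m q
  multipleOf-pow⇒padicSmall {m} {N} m≤N (multiple {r} zr refl) =
    cleared⇒padicSmall (integral-* (integral-ℕtoℚ (p ℕ.^ (N ∸ m))) zr)
    where
    pᴺ≡pᵐ*pᴺ⁻ᵐ : ℕtoℚ (p ℕ.^ N) ≡ ℕtoℚ (p ℕ.^ m) * ℕtoℚ (p ℕ.^ (N ∸ m))
    pᴺ≡pᵐ*pᴺ⁻ᵐ = trans (cong (λ e → ℕtoℚ (p ℕ.^ e)) (sym (ℕ.m+[n∸m]≡n m≤N)))
      (trans (cong ℕtoℚ (ℕ.^-distribˡ-+-* p m (N ∸ m))) (ℕtoℚ-* (p ℕ.^ m) (p ℕ.^ (N ∸ m))))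
    cleared⇒padicSmall : Integral (ℕtoℚ (p ℕ.^ (N ∸ m)) * r) → padicSmall p m (ℕtoℚ (p ℕ.^ N) * r)
    cleared⇒padicSmall (integral b p∤b a cleared) = padicSmall-of-cleared m (ℕtoℚ (p ℕ.^ N) * r) b a p∤b (begin
      ℕtoℚ (p ℕ.^ N) * r * ℕtoℚ b                              ≡⟨ cong (λ u → u * r * ℕtoℚ b) pᴺ≡pᵐ*pᴺ⁻ᵐ ⟩
      ℕtoℚ (p ℕ.^ m) * ℕtoℚ (p ℕ.^ (N ∸ m)) * r * ℕtoℚ b       ≡⟨ cong (_* ℕtoℚ b) (*-assoc (ℕtoℚ (p ℕ.^ m)) (ℕtoℚ (p ℕ.^ (N ∸ m))) r) ⟩
      ℕtoℚ (p ℕ.^ m) * (ℕtoℚ (p ℕ.^ (N ∸ m)) * r) * ℕtoℚ b     ≡⟨ *-assoc (ℕtoℚ (p ℕ.^ m)) (ℕtoℚ (p ℕ.^ (N ∸ m)) * r) (ℕtoℚ b) ⟩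
      ℕtoℚ (p ℕ.^ m) * (ℕtoℚ (p ℕ.^ (N ∸ m)) * r * ℕtoℚ b)     ≡⟨ cong (ℕtoℚ (p ℕ.^ m) *_) cleared ⟩
      ℕtoℚ (p ℕ.^ m) * ℤtoℚ a                                  ≡⟨ sym (ℤtoℚ-* (ℤ.+ (p ℕ.^ m)) a) ⟩
      ℤtoℚ (ℤ.+ (p ℕ.^ m) ℤ.* a)                               ∎)
      where open ≡-Reasoning

  record FermiCongruent (N : ℕ) (f : ℚ → ℚ) (L : ℚ) : Set where
    constructor fermiCongruent
    field
      difference : MultipleOf (p ℕ.^ N) (fermiSum p f N - L)

  fermionicIntegral≡-of-congruent : ∀ {f L} → (∀ N → FermiCongruent N f L) → FermionicIntegral≡ p f L
  fermionicIntegral≡-of-congruent congruent m =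
    m , λ N m≤N → multipleOf-pow⇒padicSmall m≤N (FermiCongruent.difference (congruent N))

  fermiCongruent-cong : ∀ {N f g L} → (∀ x → f x ≡ g x) → FermiCongruent N f L → FermiCongruent N g L
  fermiCongruent-cong {N} {L = L} f≗g (fermiCongruent d) = fermiCongruent
    (subst (λ s → MultipleOf (p ℕ.^ N) (s - L)) (sumTo-cong (p ℕ.^ N) (λ x → cong (sgn x *_) (f≗g (ℕtoℚ x)))) d)

  fermiCongruent-+-* : ∀ {N f g L L′ c} → Integral c → FermiCongruent N f L → FermiCongruent N g L′ →
    FermiCongruent N (λ x → f x + c * g x) (L + c * L′)
  fermiCongruent-+-* {N} {f} {g} {L} {L′} {c} zc (fermiCongruent df) (fermiCongruent dg) = fermiCongruent
    (subst (MultipleOf (p ℕ.^ N)) (sym linearity) (multipleOf-+ df (multipleOf-*ˡ zc dg)))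
    where
    M : ℕ
    M = p ℕ.^ N
    rearrange : ∀ a b c L L′ → (a + c * b) - (L + c * L′) ≡ (a - L) + c * (b - L′)
    rearrange = solve 5 (λ a b c L L′ → (a :+ c :* b) :- (L :+ c :* L′) := (a :- L) :+ c :* (b :- L′)) refl
    linearity : fermiSum p (λ x → f x + c * g x) N - (L + c * L′) ≡ (fermiSum p f N - L) + c * (fermiSum p g N - L′)
    linearity = begin
      sumTo M (λ x → sgn x * (f (ℕtoℚ x) + c * g (ℕtoℚ x))) - (L + c * L′)
        ≡⟨ cong (_- (L + c * L′)) (sumTo-cong M (λ x → distribute (sgn x) (f (ℕtoℚ x)) c (g (ℕtoℚ x)))) ⟩
      sumTo M (λ x → sgn x * f (ℕtoℚ x) + c * (sgn x * g (ℕtoℚ x))) - (L + c * L′)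
        ≡⟨ cong (_- (L + c * L′)) (trans (sumTo-+ M _ _) (cong (fermiSum p f N +_) (sumTo-*ˡ M c _))) ⟩
      (fermiSum p f N + c * fermiSum p g N) - (L + c * L′)
        ≡⟨ rearrange (fermiSum p f N) (fermiSum p g N) c L L′ ⟩
      (fermiSum p f N - L) + c * (fermiSum p g N - L′) ∎
      where
      open ≡-Reasoning
      distribute : ∀ s a c b → s * (a + c * b) ≡ s * a + c * (s * b)
      distribute = solve 4 (λ s a c b → s :* (a :+ c :* b) := s :* a :+ c :* (s :* b)) refl

  module _ (p≢2 : p ≢ 2) where

    p∤2 : ¬ p ∣ 2
    p∤2 p∣2 with prime⇒irreducible prime[2] p∣2
    ... | inj₁ p≡1 = p∤1 (subst (_∣ 1) (sym p≡1) (1∣ 1))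
    ... | inj₂ p≡2 = p≢2 p≡2

    2∤p^ : ∀ N → ¬ 2 ∣ p ℕ.^ N
    2∤p^ zero    2∣1 = contradiction (∣1⇒≡1 2∣1) (λ ())
    2∤p^ (suc N) 2∣p^N+1 with euclidsLemma p (p ℕ.^ N) prime[2] 2∣p^N+1
    ... | inj₁ 2∣p with prime⇒irreducible p-prime 2∣p
    ...   | inj₁ ()
    ...   | inj₂ 2≡p = p≢2 (sym 2≡p)
    2∤p^ (suc N) _ | inj₂ 2∣p^N = 2∤p^ N 2∣p^N

    integral-½ : Integral ½
    integral-½ = integral 2 p∤2 (ℤ.+ 1) refl

    integral-t : ∀ n k → Integral (t n k)
    integral-t zero    zero    = integral-ℕtoℚ 1
    integral-t zero    (suc k) = integral-ℕtoℚ 0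
    integral-t (suc m) zero    = integral-ℕtoℚ 0
    -- ℤtoℚ -[1+ i ] is definitionally - ℕtoℚ (suc i).
    integral-t (suc m) (suc k) = integral-coeff-prodLinTo m
      (λ i → integral-+ (integral-* (integral-ℕtoℚ (suc m)) integral-½) (integral-ℤtoℚ ℤ.-[1+ i ])) k

    eulerDefect-multipleOf : ∀ M → sgn M ≡ - 1ℚ → ∀ k → MultipleOf M (eulerDefect M k)
    eulerDefect-multipleOf M sgnM = <-rec (λ k → MultipleOf M (eulerDefect M k)) step
      where
      step : ∀ k → (∀ {j} → j < k → MultipleOf M (eulerDefect M j)) → MultipleOf M (eulerDefect M k)
      step zero    _  = subst (MultipleOf M) (sym (eulerDefect-zero M sgnM)) multipleOf-0
      step (suc k) ih = subst (MultipleOf M) (sym (eulerDefect-suc M sgnM k))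
        (multipleOf-*ˡ integral-½ (multipleOf-− (multipleOf-* (integral-^ k (integral-ℕtoℚ M)))
          (multipleOf-sumTo (suc k) (λ j j<1+k → multipleOf-*ˡ (integral-ℕtoℚ (suc k C j)) (ih j<1+k)))))

    fermiCongruent-polynomial : ∀ N d {a : ℕ → ℚ} → (∀ j → Integral (a j)) →
      FermiCongruent N (λ x → sumTo d (λ j → a j * x ^ j)) (sumTo d (λ j → a j * E j))
    fermiCongruent-polynomial N d {a} za = fermiCongruent (subst (MultipleOf M) (sym defect)
      (multipleOf-sumTo d (λ j _ → multipleOf-*ˡ (za j) (eulerDefect-multipleOf M (sgn-odd (2∤p^ N)) j))))
      where
      M : ℕ
      M = p ℕ.^ N
      defect : fermiSum p (λ x → sumTo d (λ j → a j * x ^ j)) N - sumTo d (λ j → a j * E j)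
             ≡ sumTo d (λ j → a j * eulerDefect M j)
      defect = trans (cong (_- sumTo d (λ j → a j * E j)) (alternatingSum-polynomial M d a))
                     (sym (sumTo-*-− d a (altPowerSum M) E))

    fermiCongruent-cfac : ∀ N n → FermiCongruent N (cfac n) (sumTo (suc n) (λ k → t n k * E k))
    fermiCongruent-cfac N n =
      fermiCongruent-cong (λ x → sym (cfac-eval n x)) (fermiCongruent-polynomial N (suc n) (integral-t n))

mainTheorem13 : (p : ℕ) → Prime p → p ≢ 2 → (n : ℕ) → 2 ≤ n →
    FermionicIntegral≡ p (λ x → x * x * cfac (n ∸ 2) x)
      (sumTo (suc n) (λ k → t n k * E k)
        + (ℕtoℚ (n ∸ 2) * ½) * (ℕtoℚ (n ∸ 2) * ½)
          * sumTo (suc (n ∸ 2)) (λ k → t (n ∸ 2) k * E k))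
mainTheorem13 p p-prime p≢2 (suc (suc k)) (s≤s (s≤s z≤n)) = fermionicIntegral≡-of-congruent p-prime λ N →
  fermiCongruent-cong p-prime (λ x → sym (cfac-step k x))
    (fermiCongruent-+-* p-prime (integral-* p-prime c-integral c-integral)
      (fermiCongruent-cfac p-prime p≢2 N (suc (suc k)))
      (fermiCongruent-cfac p-prime p≢2 N k))
  where
  c-integral : Integral p-prime (ℕtoℚ k * ½)
  c-integral = integral-* p-prime (integral-ℕtoℚ p-prime k) (integral-½ p-prime p≢2)
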